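{- Let $G_1$ and $G_2$ be vertex-disjoint connected graphs, $u\in V(G_1)$, $v\in V(G_2)$, and $m\ge 2$. Let $G_1P_mG_2$ be the graph obtained from $G_1\cup G_2$ by adding a path $P_m$ on $m$ vertices whose end vertices are $u$ and $v$ (its $m-2$ internal vertices being new). Let $G_1G_2P_m$ be the graph obtained from $G_1\cup G_2$ by identifying $u$ and $v$ into a single vertex $w$ and attaching at $w$ a pendent path with $m-1$ new vertices (i.e., a path $P_m$ one of whose end vertices is $w$). Then $\Pi_1(G_1P_mG_2)\ge \Pi_1(G_1G_2P_m)$ and $\Pi_2(G_1P_mG_2)\le \Pi_2(G_1G_2P_m)$.
   Context: For a graph $G$ with vertex degrees $d(u)$: $\Pi_1(G)=\prod_{u\in V(G)} d(u)^2$ and $\Pi_2(G)=\prod_{uv\in E(G)} d(u)d(v)=\prod_{u\in V(G)} d(u)^{d(u)}$. -}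

module Defs where

open import Data.Nat using (ℕ; zero; suc; _+_; _*_; _^_; _≡ᵇ_)

open import Data.Bool using (Bool; true; false; _∧_; _∨_; if_then_else_; T)
open import Data.Bool.Properties using (∨-comm; ∧-comm)
open import Data.Fin using (Fin; toℕ; punchIn; splitAt)
open import Data.Fin.Properties using (_≟_)
open import Data.Sum using (_⊎_; inj₁; inj₂)
open import Data.List using (List; map; allFin)
open import Data.Nat.ListAction using (sum; product)
open import Relation.Nullary.Decidable using (⌊_⌋)
open import Relation.Binary.PropositionalEquality using (_≡_; refl; sym)

record Graph (n : ℕ) : Set where
  field
    adj    : Fin n → Fin n → Bool
    adj-sym : ∀ x y → adj x y ≡ adj y x
    adj-irr : ∀ x → adj x x ≡ false
open Graph public

data Reach {n : ℕ} (G : Graph n) : Fin n → Fin n → Set where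
  here : ∀ {x} → Reach G x x
  step : ∀ {x y z} → adj G x y ≡ true → Reach G y z → Reach G x z

Connected : {n : ℕ} → Graph n → Set
Connected {n} G = (x y : Fin n) → Reach G x y

deg : {n : ℕ} → Graph n → Fin n → ℕ
deg {n} G x = sum (map (λ y → if adj G x y then 1 else 0) (allFin n))

Pi1 : {n : ℕ} → Graph n → ℕ
Pi1 {n} G = product (map (λ x → deg G x ^ 2) (allFin n))

-- Π₂(G) = ∏_u d(u)^{d(u)}  (= ∏_{uv ∈ E} d(u) d(v))
Pi2 : {n : ℕ} → Graph n → ℕ
Pi2 {n} G = product (map (λ x → deg G x ^ deg G x) (allFin n))

_=F_ : {n : ℕ} → Fin n → Fin n → Bool
a =F b = ⌊ a ≟ b ⌋

pathAdj : {k : ℕ} → Fin k → Fin k → Bool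
pathAdj i j = (suc (toℕ i) ≡ᵇ toℕ j) ∨ (suc (toℕ j) ≡ᵇ toℕ i)

pathAdj-sym : {k : ℕ} (i j : Fin k) → pathAdj i j ≡ pathAdj j i
pathAdj-sym i j = ∨-comm (suc (toℕ i) ≡ᵇ toℕ j) (suc (toℕ j) ≡ᵇ toℕ i)

private
  sucb : ∀ n → (suc n ≡ᵇ n) ≡ false
  sucb zero = refl
  sucb (suc n) = sucb n

pathAdj-irr : {k : ℕ} (i : Fin k) → pathAdj i i ≡ false
pathAdj-irr i rewrite sucb (toℕ i) = refl

isZero : ℕ → Bool
isZero zero = true
isZero (suc _) = false

-- G₁ P_m G₂, with m = k + 2 (k = m - 2 new internal path vertices).
-- Path: u — p₀ — p₁ — … — p_{k-1} — v  (and u — v directly if k = 0).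

module PathJoin {n₁ n₂ k : ℕ} (G₁ : Graph n₁) (G₂ : Graph n₂)
                (u : Fin n₁) (v : Fin n₂) where

  V = Fin n₁ ⊎ (Fin n₂ ⊎ Fin k)

  A : V → V → Bool
  A (inj₁ a) (inj₁ b) = adj G₁ a b
  A (inj₂ (inj₁ a)) (inj₂ (inj₁ b)) = adj G₂ a b
  A (inj₂ (inj₂ i)) (inj₂ (inj₂ j)) = pathAdj i j
  A (inj₁ a) (inj₂ (inj₁ b)) = isZero k ∧ (a =F u ∧ b =F v)
  A (inj₂ (inj₁ b)) (inj₁ a) = isZero k ∧ (a =F u ∧ b =F v)
  A (inj₁ a) (inj₂ (inj₂ i)) = a =F u ∧ (toℕ i ≡ᵇ 0)
  A (inj₂ (inj₂ i)) (inj₁ a) = a =F u ∧ (toℕ i ≡ᵇ 0)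
  A (inj₂ (inj₁ b)) (inj₂ (inj₂ i)) = b =F v ∧ (suc (toℕ i) ≡ᵇ k)
  A (inj₂ (inj₂ i)) (inj₂ (inj₁ b)) = b =F v ∧ (suc (toℕ i) ≡ᵇ k)

  A-sym : ∀ x y → A x y ≡ A y x
  A-sym (inj₁ a) (inj₁ b) = adj-sym G₁ a b
  A-sym (inj₂ (inj₁ a)) (inj₂ (inj₁ b)) = adj-sym G₂ a b
  A-sym (inj₂ (inj₂ i)) (inj₂ (inj₂ j)) = pathAdj-sym i j
  A-sym (inj₁ a) (inj₂ (inj₁ b)) = refl
  A-sym (inj₂ (inj₁ b)) (inj₁ a) = refl
  A-sym (inj₁ a) (inj₂ (inj₂ i)) = refl
  A-sym (inj₂ (inj₂ i)) (inj₁ a) = refl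
  A-sym (inj₂ (inj₁ b)) (inj₂ (inj₂ i)) = refl
  A-sym (inj₂ (inj₂ i)) (inj₂ (inj₁ b)) = refl

  A-irr : ∀ x → A x x ≡ false
  A-irr (inj₁ a) = adj-irr G₁ a
  A-irr (inj₂ (inj₁ b)) = adj-irr G₂ b
  A-irr (inj₂ (inj₂ i)) = pathAdj-irr i

  dec : Fin (n₁ + (n₂ + k)) → V
  dec x with splitAt n₁ x
  ... | inj₁ a = inj₁ a
  ... | inj₂ y = inj₂ (splitAt n₂ y)

  graph : Graph (n₁ + (n₂ + k))
  graph = record
    { adj = λ x y → A (dec x) (dec y)
    ; adj-sym = λ x y → A-sym (dec x) (dec y)
    ; adj-irr = λ x → A-irr (dec x)
    }

G₁P[_]G₂ : {n₁ n₂ : ℕ} (k : ℕ) (G₁ : Graph n₁) (G₂ : Graph n₂)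
         → Fin n₁ → Fin n₂ → Graph (n₁ + (n₂ + k))
G₁P[ k ]G₂ G₁ G₂ u v = PathJoin.graph {k = k} G₁ G₂ u v

-- G₁ G₂ P_m, with m = k + 2: identify u ∈ G₁ and v ∈ G₂ into w (= u),
-- and attach at w a pendent path with m - 1 = k + 1 new vertices.
-- G₂ has n₂ + 1 vertices; its vertices other than v are punchIn v j,
-- j : Fin n₂.  Vertices: Fin (n₁ + (n₂ + suc k)), decoded as
-- G₁ ⊎ (G₂ - v) ⊎ path, with path w — q₀ — q₁ — … — q_k.

module Identify {n₁ n₂ k : ℕ} (G₁ : Graph n₁) (G₂ : Graph (suc n₂))
                (u : Fin n₁) (v : Fin (suc n₂)) where

  V = Fin n₁ ⊎ (Fin n₂ ⊎ Fin (suc k))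

  A : V → V → Bool
  A (inj₁ a) (inj₁ b) = adj G₁ a b
  A (inj₂ (inj₁ a)) (inj₂ (inj₁ b)) = adj G₂ (punchIn v a) (punchIn v b)
  A (inj₂ (inj₂ i)) (inj₂ (inj₂ j)) = pathAdj i j
  A (inj₁ a) (inj₂ (inj₁ b)) = a =F u ∧ adj G₂ v (punchIn v b)
  A (inj₂ (inj₁ b)) (inj₁ a) = a =F u ∧ adj G₂ v (punchIn v b)
  A (inj₁ a) (inj₂ (inj₂ i)) = a =F u ∧ (toℕ i ≡ᵇ 0)
  A (inj₂ (inj₂ i)) (inj₁ a) = a =F u ∧ (toℕ i ≡ᵇ 0)
  A (inj₂ (inj₁ b)) (inj₂ (inj₂ i)) = false
  A (inj₂ (inj₂ i)) (inj₂ (inj₁ b)) = false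

  A-sym : ∀ x y → A x y ≡ A y x
  A-sym (inj₁ a) (inj₁ b) = adj-sym G₁ a b
  A-sym (inj₂ (inj₁ a)) (inj₂ (inj₁ b)) = adj-sym G₂ (punchIn v a) (punchIn v b)
  A-sym (inj₂ (inj₂ i)) (inj₂ (inj₂ j)) = pathAdj-sym i j
  A-sym (inj₁ a) (inj₂ (inj₁ b)) = refl
  A-sym (inj₂ (inj₁ b)) (inj₁ a) = refl
  A-sym (inj₁ a) (inj₂ (inj₂ i)) = refl
  A-sym (inj₂ (inj₂ i)) (inj₁ a) = refl
  A-sym (inj₂ (inj₁ b)) (inj₂ (inj₂ i)) = refl
  A-sym (inj₂ (inj₂ i)) (inj₂ (inj₁ b)) = refl

  A-irr : ∀ x → A x x ≡ false
  A-irr (inj₁ a) = adj-irr G₁ a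
  A-irr (inj₂ (inj₁ b)) = adj-irr G₂ (punchIn v b)
  A-irr (inj₂ (inj₂ i)) = pathAdj-irr i

  dec : Fin (n₁ + (n₂ + suc k)) → V
  dec x with splitAt n₁ x
  ... | inj₁ a = inj₁ a
  ... | inj₂ y = inj₂ (splitAt n₂ y)

  graph : Graph (n₁ + (n₂ + suc k))
  graph = record
    { adj = λ x y → A (dec x) (dec y)
    ; adj-sym = λ x y → A-sym (dec x) (dec y)
    ; adj-irr = λ x → A-irr (dec x)
    }

G₁G₂P[_] : {n₁ n₂ : ℕ} (k : ℕ) (G₁ : Graph n₁) (G₂ : Graph (suc n₂))
         → Fin n₁ → Fin (suc n₂) → Graph (n₁ + (n₂ + suc k))
G₁G₂P[ k ] G₁ G₂ u v = Identify.graph {k = k} G₁ G₂ u v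

-- Write a = d_{G₁}(u) and b = d_{G₂}(v).  Every vertex of G₁ - u and of G₂ - v
-- keeps its degree in both graphs, and the remaining degrees are
--   G₁P_mG₂ :  1+a (at u), 1+b (at v), 2 (at each of the m-2 internal vertices),
--   G₁G₂P_m :  1+a+b (at w), 2 (at m-2 path vertices), 1 (at the pendent end).
-- Hence for every f, the product Π_f(G) = ∏_x f(d(x)) factors as
--   Π_f(G₁P_mG₂) = f(1+a) f(1+b) · R   and   Π_f(G₁G₂P_m) = f(1+a+b) f(1) · R
-- with the same R.  For f(d) = d² and f(d) = d^d the theorem thus reduces to
--   (1+a+b)² ≤ (1+a)² (1+b)²   and   (1+a)^(1+a) (1+b)^(1+b) ≤ (1+a+b)^(1+a+b),
-- the latter a consequence of Bernoulli's inequality.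

module Submission where

open import Defs
open import Algebra.Bundles using (Monoid)
open import Level using (0ℓ)
open import Data.Bool using (Bool; true; false; _∧_; _∨_; if_then_else_; T)
open import Data.Bool.Properties using (∧-comm; ∧-zeroʳ)
open import Data.Nat using (ℕ; zero; suc; _+_; _*_; _^_; _≤_; _≥_; _≡ᵇ_; _<ᵇ_; s≤s)
open import Data.Nat.Properties
  using (+-0-monoid; *-1-monoid; *-1-commutativeMonoid; +-*-semiring;
         +-comm; +-suc; +-identityʳ; *-assoc; *-identityˡ; *-identityʳ;
         ≤-refl; ≤-reflexive; <⇒≤; m≤m+n; m≤n+m; m≤m*n; +-monoʳ-≤; *-mono-≤; *-monoʳ-≤; *-monoˡ-≤;
         *-cancelʳ-≤; ^-monoˡ-≤; ^-distribˡ-+-*; <⇒<ᵇ; module ≤-Reasoning)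
open import Data.Nat.Tactic.RingSolver using (solve-∀)
open import Data.Fin using (Fin; zero; suc; toℕ; punchIn; splitAt)
open import Data.Fin.Properties using (_≟_; punchInᵢ≢i; toℕ<n)
open import Data.Sum using (_⊎_; inj₁; inj₂; [_,_])
import Data.Sum as Sum
open import Data.Product using (_×_; _,_)
open import Data.List using (allFin; tabulate) renaming (foldr to foldrᴸ; map to mapᴸ)
open import Data.List.Properties using (map-tabulate)
open import Data.Vec.Functional using (foldr)
open import Function using (_∘_; id)
open import Relation.Nullary using (yes; no; contradiction)
open import Relation.Binary.PropositionalEquality using (_≡_; _≢_; refl; sym; trans; cong; cong₂; module ≡-Reasoning)
import Algebra.Properties.Monoid.Sum as MonoidSum
import Algebra.Properties.CommutativeMonoid.Sum as CommutativeMonoidSum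
import Algebra.Properties.Semiring.Sum as SemiringSum

open SemiringSum +-*-semiring
  using (∑-distrib-+; *-distribˡ-sum; sum-replicate-zero; sum-cong-≗)
  renaming (sum to ∑; sum-remove to ∑-remove)
open CommutativeMonoidSum *-1-commutativeMonoid
  using () renaming (sum to ∏; sum-cong-≗ to ∏-cong; sum-remove to ∏-remove)

∑-cong : ∀ {n} {g h : Fin n → ℕ} → (∀ i → g i ≡ h i) → ∑ g ≡ ∑ h
∑-cong = sum-cong-≗

foldr-allFin : ∀ (op : ℕ → ℕ → ℕ) e {n} (g : Fin n → ℕ) → foldrᴸ op e (mapᴸ g (allFin n)) ≡ foldr op e g
foldr-allFin op e {n} g = trans (cong (foldrᴸ op e) (map-tabulate id g)) (fold-tabulate n g)
  where
  fold-tabulate : ∀ n (g : Fin n → ℕ) → foldrᴸ op e (tabulate g) ≡ foldr op e g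
  fold-tabulate zero g = refl
  fold-tabulate (suc n) g = cong (op (g zero)) (fold-tabulate n (g ∘ suc))

V₃ : ℕ → ℕ → ℕ → Set
V₃ a b c = Fin a ⊎ (Fin b ⊎ Fin c)

split₃ : ∀ a b c → Fin (a + (b + c)) → V₃ a b c
split₃ a b c = [ inj₁ , inj₂ ∘ splitAt b ] ∘ splitAt a

module BlockSums (M : Monoid 0ℓ 0ℓ) where
  open Monoid M using (Carrier; _≈_; _∙_; ∙-congˡ; assoc; identityˡ; setoid)
    renaming (sym to ≈-sym; trans to ≈-trans)
  open MonoidSum M using (sum)
  open import Relation.Binary.Reasoning.Setoid setoid

  sum-⊎ : ∀ m {n} (h : Fin m ⊎ Fin n → Carrier) → sum (h ∘ splitAt m) ≈ sum (h ∘ inj₁) ∙ sum (h ∘ inj₂)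
  sum-⊎ zero h = ≈-sym (identityˡ _)
  sum-⊎ (suc m) h = begin
    h (inj₁ zero) ∙ sum (h ∘ Sum.map₁ suc ∘ splitAt m)
      ≈⟨ ∙-congˡ (sum-⊎ m (h ∘ Sum.map₁ suc)) ⟩
    h (inj₁ zero) ∙ (sum (h ∘ inj₁ ∘ suc) ∙ sum (h ∘ inj₂))
      ≈⟨ ≈-sym (assoc _ _ _) ⟩
    sum (h ∘ inj₁) ∙ sum (h ∘ inj₂) ∎

  sum-split₃ : ∀ a b c (h : V₃ a b c → Carrier) →
    sum (h ∘ split₃ a b c) ≈ sum (h ∘ inj₁) ∙ (sum (h ∘ inj₂ ∘ inj₁) ∙ sum (h ∘ inj₂ ∘ inj₂))
  sum-split₃ a b c h = ≈-trans (sum-⊎ a (h ∘ [ inj₁ , inj₂ ∘ splitAt b ])) (∙-congˡ (sum-⊎ b (h ∘ inj₂)))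

open BlockSums +-0-monoid using () renaming (sum-split₃ to ∑-split₃)
open BlockSums *-1-monoid using () renaming (sum-split₃ to ∏-split₃)

∏-const : ∀ n x → ∏ {n} (λ _ → x) ≡ x ^ n
∏-const zero x = refl
∏-const (suc n) x = cong (x *_) (∏-const n x)

𝟙 : Bool → ℕ
𝟙 b = if b then 1 else 0

𝟙-T : ∀ {b} → T b → 𝟙 b ≡ 1
𝟙-T {true} _ = refl

𝟙-∧ : ∀ x y → 𝟙 (x ∧ y) ≡ 𝟙 x * 𝟙 y
𝟙-∧ false y = refl
𝟙-∧ true y = sym (+-identityʳ (𝟙 y))

𝟙-∨ : ∀ x y → (x ∧ y) ≡ false → 𝟙 (x ∨ y) ≡ 𝟙 x + 𝟙 y
𝟙-∨ true false _ = refl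
𝟙-∨ false y _ = refl

-- Along a path with k + 1 vertices, k have degree 2 and the last has degree 1.
∏-pendent-path : ∀ k (f : ℕ → ℕ) → ∏ (λ (i : Fin (suc k)) → f (suc (𝟙 (toℕ i <ᵇ k)))) ≡ f 2 ^ k * f 1
∏-pendent-path zero f = trans (*-identityʳ (f 1)) (sym (*-identityˡ (f 1)))
∏-pendent-path (suc k) f = trans (cong (f 2 *_) (∏-pendent-path k f)) (sym (*-assoc (f 2) _ _))

∑-guardˡ : ∀ {n} c (P : Fin n → Bool) → ∑ (λ i → 𝟙 (c ∧ P i)) ≡ 𝟙 c * ∑ (𝟙 ∘ P)
∑-guardˡ c P = trans (∑-cong (λ i → 𝟙-∧ c (P i))) (sym (*-distribˡ-sum (𝟙 c) (𝟙 ∘ P)))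

∑-guardʳ : ∀ {n} c (P : Fin n → Bool) → ∑ (λ i → 𝟙 (P i ∧ c)) ≡ 𝟙 c * ∑ (𝟙 ∘ P)
∑-guardʳ c P = trans (∑-cong (λ i → cong 𝟙 (∧-comm (P i) c))) (∑-guardˡ c P)

=F-refl : ∀ {n} (x : Fin n) → (x =F x) ≡ true
=F-refl x with x ≟ x
... | yes _ = refl
... | no x≢x = contradiction refl x≢x

=F-≢ : ∀ {n} {x y : Fin n} → x ≢ y → (x =F y) ≡ false
=F-≢ {x = x} {y} x≢y with x ≟ y
... | yes x≡y = contradiction x≡y x≢y
... | no _ = refl

count-=F : ∀ {n} (u : Fin (suc n)) → ∑ (λ a → 𝟙 (a =F u)) ≡ 1
count-=F {n} u = begin
  ∑ (λ a → 𝟙 (a =F u))                         ≡⟨ ∑-remove {i = u} (λ a → 𝟙 (a =F u)) ⟩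
  𝟙 (u =F u) + ∑ (λ j → 𝟙 (punchIn u j =F u))  ≡⟨ cong₂ _+_ (cong 𝟙 (=F-refl u)) no-other ⟩
  1                                             ∎
  where
  open ≡-Reasoning
  no-other : ∑ (λ j → 𝟙 (punchIn u j =F u)) ≡ 0
  no-other = trans (∑-cong (λ j → cong 𝟙 (=F-≢ (punchInᵢ≢i u j)))) (sum-replicate-zero n)

count-index : ∀ k c → ∑ (λ (j : Fin k) → 𝟙 (toℕ j ≡ᵇ c)) ≡ 𝟙 (c <ᵇ k)
count-index zero c = refl
count-index (suc k) zero = cong suc (sum-replicate-zero k)
count-index (suc k) (suc c) = count-index k c

count-predecessor : ∀ {k t} → t ≤ k → ∑ (λ (j : Fin k) → 𝟙 (suc (toℕ j) ≡ᵇ t)) ≡ 𝟙 (0 <ᵇ t)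
count-predecessor {k} {zero} _ = sum-replicate-zero k
count-predecessor {k} {suc t} t<k = trans (count-index k t) (𝟙-T (<⇒<ᵇ t<k))

≡ᵇ-sym : ∀ s t → (s ≡ᵇ t) ≡ (t ≡ᵇ s)
≡ᵇ-sym zero zero = refl
≡ᵇ-sym zero (suc t) = refl
≡ᵇ-sym (suc s) zero = refl
≡ᵇ-sym (suc s) (suc t) = ≡ᵇ-sym s t

not-mutual-successors : ∀ t s → ((suc t ≡ᵇ s) ∧ (suc s ≡ᵇ t)) ≡ false
not-mutual-successors t zero = refl
not-mutual-successors zero (suc s) = ∧-zeroʳ _
not-mutual-successors (suc t) (suc s) = not-mutual-successors t s

path-degree : ∀ {k} (i : Fin k) → ∑ (λ j → 𝟙 (pathAdj i j)) ≡ 𝟙 (suc (toℕ i) <ᵇ k) + 𝟙 (0 <ᵇ toℕ i)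
path-degree {k} i = begin
  ∑ (λ (j : Fin k) → 𝟙 ((suc t ≡ᵇ toℕ j) ∨ (suc (toℕ j) ≡ᵇ t)))
    ≡⟨ ∑-cong {k} (λ j → 𝟙-∨ (suc t ≡ᵇ toℕ j) (suc (toℕ j) ≡ᵇ t) (not-mutual-successors t (toℕ j))) ⟩
  ∑ (λ (j : Fin k) → 𝟙 (suc t ≡ᵇ toℕ j) + 𝟙 (suc (toℕ j) ≡ᵇ t))
    ≡⟨ ∑-distrib-+ (λ (j : Fin k) → 𝟙 (suc t ≡ᵇ toℕ j)) (λ (j : Fin k) → 𝟙 (suc (toℕ j) ≡ᵇ t)) ⟩
  ∑ (λ (j : Fin k) → 𝟙 (suc t ≡ᵇ toℕ j)) + ∑ (λ (j : Fin k) → 𝟙 (suc (toℕ j) ≡ᵇ t))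
    ≡⟨ cong₂ _+_ successor predecessor ⟩
  𝟙 (suc t <ᵇ k) + 𝟙 (0 <ᵇ t) ∎
  where
  open ≡-Reasoning
  t = toℕ i
  successor : ∑ (λ (j : Fin k) → 𝟙 (suc t ≡ᵇ toℕ j)) ≡ 𝟙 (suc t <ᵇ k)
  successor = trans (∑-cong (λ (j : Fin k) → cong 𝟙 (≡ᵇ-sym (suc t) (toℕ j)))) (count-index k (suc t))
  predecessor : ∑ (λ (j : Fin k) → 𝟙 (suc (toℕ j) ≡ᵇ t)) ≡ 𝟙 (0 <ᵇ t)
  predecessor = count-predecessor (<⇒≤ (toℕ<n i))

zero-or-positive : ∀ t → 𝟙 (t ≡ᵇ 0) + 𝟙 (0 <ᵇ t) ≡ 1
zero-or-positive zero = refl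
zero-or-positive (suc t) = refl

equal-or-less : ∀ {s k} → s ≤ k → 𝟙 (s ≡ᵇ k) + 𝟙 (s <ᵇ k) ≡ 1
equal-or-less {zero} {zero} _ = refl
equal-or-less {zero} {suc k} _ = refl
equal-or-less {suc s} {suc k} (s≤s s≤k) = equal-or-less s≤k

-- An end of a joining path with k internal vertices gets exactly one new
-- neighbour: the other end if k = 0, an internal vertex otherwise.
end-edges : ∀ k c → 𝟙 (isZero k) * (𝟙 c * 1) + 𝟙 c * 𝟙 (0 <ᵇ k) ≡ 𝟙 c * 1
end-edges zero false = refl
end-edges zero true = refl
end-edges (suc k) c = refl

-- Bernoulli's inequality (1 + c/x)^m ≥ 1 + mc/x, cleared of denominators.
bernoulli : ∀ x c m → x ^ m * (x + m * c) ≤ (x + c) ^ m * x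
bernoulli x c zero = ≤-reflexive (distribute x)
  where
  distribute : ∀ x → 1 * (x + 0) ≡ 1 * x
  distribute = solve-∀
bernoulli x c (suc m) = begin
  x * x ^ m * (x + suc m * c)                        ≤⟨ m≤m+n _ _ ⟩
  x * x ^ m * (x + suc m * c) + x ^ m * m * c * c    ≡⟨ regroup x c m (x ^ m) ⟩
  (x + c) * (x ^ m * (x + m * c))                    ≤⟨ *-monoʳ-≤ (x + c) (bernoulli x c m) ⟩
  (x + c) * ((x + c) ^ m * x)                        ≡⟨ sym (*-assoc (x + c) _ x) ⟩
  (x + c) * (x + c) ^ m * x                          ∎
  where
  open ≤-Reasoning
  regroup : ∀ x c m p → x * p * (x + suc m * c) + p * m * c * c ≡ (x + c) * (p * (x + m * c))
  regroup = solve-∀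

-- Bernoulli with m = x = y: y^y (1 + c) ≤ (y + c)^y for y ≥ 1.
bernoulli-self : ∀ y c → suc y ^ suc y * suc c ≤ (suc y + c) ^ suc y
bernoulli-self y c = *-cancelʳ-≤ _ _ (suc y) (begin
  suc y ^ suc y * suc c * suc y      ≡⟨ factor (suc y ^ suc y) (suc y) c ⟩
  suc y ^ suc y * (suc y + suc y * c) ≤⟨ bernoulli (suc y) c (suc y) ⟩
  (suc y + c) ^ suc y * suc y         ∎)
  where
  open ≤-Reasoning
  factor : ∀ p x c → p * suc c * x ≡ p * (x + x * c)
  factor = solve-∀

-- The Π₁ comparison of the changed degrees {1+a+b, 1} versus {1+a, 1+b}.
Π₁-local : ∀ a b → suc (b + a) ^ 2 * 1 ^ 2 ≤ suc a ^ 2 * suc b ^ 2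
Π₁-local a b = begin
  suc (b + a) ^ 2 * 1     ≡⟨ *-identityʳ _ ⟩
  suc (b + a) ^ 2         ≤⟨ ^-monoˡ-≤ 2 (s≤s (+-monoʳ-≤ b (m≤m*n a (suc b)))) ⟩
  (suc a * suc b) ^ 2     ≡⟨ square-product (suc a) (suc b) ⟩
  suc a ^ 2 * suc b ^ 2   ∎
  where
  open ≤-Reasoning
  square-product : ∀ x y → x * y * (x * y * 1) ≡ x * (x * 1) * (y * (y * 1))
  square-product = solve-∀

-- The Π₂ comparison: (1+a)^(1+a) (1+b)^(1+b) ≤ (1+a+b)^(1+a+b).  Bound (1+a)^a
-- trivially and (1+b)^(1+b) (1+a) by Bernoulli.
Π₂-local : ∀ a b → suc a ^ suc a * suc b ^ suc b ≤ suc (b + a) ^ suc (b + a) * 1 ^ 1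
Π₂-local a b = begin
  suc a ^ suc a * suc b ^ suc b          ≡⟨ regroup (suc a) (suc a ^ a) (suc b ^ suc b) ⟩
  suc a ^ a * (suc b ^ suc b * suc a)    ≤⟨ *-mono-≤ (^-monoˡ-≤ a (s≤s (m≤n+m a b))) (bernoulli-self b a) ⟩
  n ^ a * n ^ suc b                      ≡⟨ sym (^-distribˡ-+-* n a (suc b)) ⟩
  n ^ (a + suc b)                        ≡⟨ cong (n ^_) (trans (+-suc a b) (cong suc (+-comm a b))) ⟩
  n ^ n                                  ≡⟨ sym (*-identityʳ _) ⟩
  n ^ n * 1                              ∎
  where
  open ≤-Reasoning
  n = suc (b + a)
  regroup : ∀ x p q → x * p * q ≡ p * (q * x)
  regroup = solve-∀

Πf : ∀ {n} → (ℕ → ℕ) → Graph n → ℕ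
Πf f G = ∏ (λ x → f (deg G x))

deg-∑ : ∀ {n} (G : Graph n) x → deg G x ≡ ∑ (λ y → 𝟙 (adj G x y))
deg-∑ G x = foldr-allFin _+_ 0 (λ y → 𝟙 (adj G x y))

deg-remove : ∀ {n} (G : Graph (suc n)) x v → deg G x ≡ 𝟙 (adj G x v) + ∑ (λ j → 𝟙 (adj G x (punchIn v j)))
deg-remove G x v = trans (deg-∑ G x) (∑-remove {i = v} (λ y → 𝟙 (adj G x y)))

blockDegree : ∀ {a b c} → (V₃ a b c → V₃ a b c → Bool) → V₃ a b c → ℕ
blockDegree A s =
  ∑ (λ i → 𝟙 (A s (inj₁ i))) + (∑ (λ j → 𝟙 (A s (inj₂ (inj₁ j)))) + ∑ (λ l → 𝟙 (A s (inj₂ (inj₂ l)))))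

module Blocks {a b c : ℕ} (G : Graph (a + (b + c))) (A : V₃ a b c → V₃ a b c → Bool)
              (adj≡A : ∀ x y → adj G x y ≡ A (split₃ a b c x) (split₃ a b c y)) where

  deg-blocks : ∀ x → deg G x ≡ blockDegree A (split₃ a b c x)
  deg-blocks x = trans (deg-∑ G x)
                       (trans (∑-cong (cong 𝟙 ∘ adj≡A x)) (∑-split₃ a b c (𝟙 ∘ A (split₃ a b c x))))

  Π-blocks : ∀ f → Πf f G ≡ ∏ (λ i → f (blockDegree A (inj₁ i)))
                           * (∏ (λ j → f (blockDegree A (inj₂ (inj₁ j))))
                              * ∏ (λ l → f (blockDegree A (inj₂ (inj₂ l)))))
  Π-blocks f = trans (∏-cong (cong f ∘ deg-blocks)) (∏-split₃ a b c (f ∘ blockDegree A))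

∏-bump : ∀ {n} (f : ℕ → ℕ) (d : Fin (suc n) → ℕ) (u : Fin (suc n)) e →
         ∏ (λ a → f (𝟙 (a =F u) * e + d a)) ≡ f (e + d u) * ∏ (λ j → f (d (punchIn u j)))
∏-bump f d u e = trans (∏-remove {i = u} (λ a → f (𝟙 (a =F u) * e + d a))) (cong₂ _*_ at-u elsewhere)
  where
  at-u : f (𝟙 (u =F u) * e + d u) ≡ f (e + d u)
  at-u = trans (cong (λ z → f (𝟙 z * e + d u)) (=F-refl u)) (cong (λ z → f (z + d u)) (*-identityˡ e))
  elsewhere : ∏ (λ j → f (𝟙 (punchIn u j =F u) * e + d (punchIn u j))) ≡ ∏ (λ j → f (d (punchIn u j)))
  elsewhere = ∏-cong (λ j → cong (λ z → f (𝟙 z * e + d (punchIn u j))) (=F-≢ (punchInᵢ≢i u j)))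

-- The factor R shared by Π_f of both constructions: the untouched vertices of
-- G₁ and G₂ and m - 2 path vertices of degree 2.
sharedFactor : ∀ {n₁ n₂} (f : ℕ → ℕ) (k : ℕ) (G₁ : Graph (suc n₁)) (G₂ : Graph (suc n₂)) →
               Fin (suc n₁) → Fin (suc n₂) → ℕ
sharedFactor f k G₁ G₂ u v = ∏ (λ j → f (deg G₁ (punchIn u j))) * (∏ (λ j → f (deg G₂ (punchIn v j))) * f 2 ^ k)

module PathJoinDegrees {n₁ n₂ : ℕ} (k : ℕ) (G₁ : Graph (suc n₁)) (G₂ : Graph (suc n₂))
                       (u : Fin (suc n₁)) (v : Fin (suc n₂)) where
  open PathJoin {k = k} G₁ G₂ u v using (A; dec)

  dec≗split₃ : ∀ x → dec x ≡ split₃ (suc n₁) (suc n₂) k x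
  dec≗split₃ x with splitAt (suc n₁) x
  ... | inj₁ _ = refl
  ... | inj₂ _ = refl

  open Blocks (G₁P[ k ]G₂ G₁ G₂ u v) A (λ x y → cong₂ A (dec≗split₃ x) (dec≗split₃ y)) using (Π-blocks)

  deg-G₁ : ∀ a → blockDegree A (inj₁ a) ≡ 𝟙 (a =F u) * 1 + deg G₁ a
  deg-G₁ a = begin
    blockDegree A (inj₁ a)
      ≡⟨ cong₂ _+_ (sym (deg-∑ G₁ a)) (cong₂ _+_ via-v via-path) ⟩
    deg G₁ a + (𝟙 (isZero k) * (𝟙 c * 1) + 𝟙 c * 𝟙 (0 <ᵇ k))
      ≡⟨ trans (cong (deg G₁ a +_) (end-edges k c)) (+-comm (deg G₁ a) _) ⟩
    𝟙 c * 1 + deg G₁ a ∎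
    where
    open ≡-Reasoning
    c = a =F u
    via-v : ∑ (λ b → 𝟙 (isZero k ∧ (c ∧ (b =F v)))) ≡ 𝟙 (isZero k) * (𝟙 c * 1)
    via-v = trans (∑-guardˡ (isZero k) (λ b → c ∧ (b =F v)))
                  (cong (𝟙 (isZero k) *_) (trans (∑-guardˡ c (_=F v)) (cong (𝟙 c *_) (count-=F v))))
    via-path : ∑ (λ (i : Fin k) → 𝟙 (c ∧ (toℕ i ≡ᵇ 0))) ≡ 𝟙 c * 𝟙 (0 <ᵇ k)
    via-path = trans (∑-guardˡ c (λ (i : Fin k) → toℕ i ≡ᵇ 0)) (cong (𝟙 c *_) (count-index k 0))

  deg-G₂ : ∀ b → blockDegree A (inj₂ (inj₁ b)) ≡ 𝟙 (b =F v) * 1 + deg G₂ b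
  deg-G₂ b = begin
    blockDegree A (inj₂ (inj₁ b))
      ≡⟨ cong₂ _+_ via-u (cong₂ _+_ (sym (deg-∑ G₂ b)) via-path) ⟩
    𝟙 (isZero k) * (𝟙 c * 1) + (deg G₂ b + 𝟙 c * 𝟙 (0 <ᵇ k))
      ≡⟨ regroup (𝟙 (isZero k) * (𝟙 c * 1)) (deg G₂ b) (𝟙 c * 𝟙 (0 <ᵇ k)) ⟩
    (𝟙 (isZero k) * (𝟙 c * 1) + 𝟙 c * 𝟙 (0 <ᵇ k)) + deg G₂ b
      ≡⟨ cong (_+ deg G₂ b) (end-edges k c) ⟩
    𝟙 c * 1 + deg G₂ b ∎
    where
    open ≡-Reasoning
    c = b =F v
    via-u : ∑ (λ a → 𝟙 (isZero k ∧ ((a =F u) ∧ c))) ≡ 𝟙 (isZero k) * (𝟙 c * 1)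
    via-u = trans (∑-guardˡ (isZero k) (λ a → (a =F u) ∧ c))
                  (cong (𝟙 (isZero k) *_) (trans (∑-guardʳ c (_=F u)) (cong (𝟙 c *_) (count-=F u))))
    via-path : ∑ (λ (i : Fin k) → 𝟙 (c ∧ (suc (toℕ i) ≡ᵇ k))) ≡ 𝟙 c * 𝟙 (0 <ᵇ k)
    via-path = trans (∑-guardˡ c (λ (i : Fin k) → suc (toℕ i) ≡ᵇ k))
                     (cong (𝟙 c *_) (count-predecessor {k} ≤-refl))
    regroup : ∀ x y z → x + (y + z) ≡ (x + z) + y
    regroup = solve-∀

  -- Every internal path vertex has degree 2 (at the two ends of the path
  -- the missing path neighbour is u, respectively v).
  deg-path : ∀ i → blockDegree A (inj₂ (inj₂ i)) ≡ 2
  deg-path i = begin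
    blockDegree A (inj₂ (inj₂ i))
      ≡⟨ cong₂ _+_ (trans (∑-guardʳ (t ≡ᵇ 0) (_=F u)) (cong (𝟙 (t ≡ᵇ 0) *_) (count-=F u)))
                   (cong₂ _+_ (trans (∑-guardʳ (suc t ≡ᵇ k) (_=F v)) (cong (𝟙 (suc t ≡ᵇ k) *_) (count-=F v)))
                              (path-degree i)) ⟩
    𝟙 (t ≡ᵇ 0) * 1 + (𝟙 (suc t ≡ᵇ k) * 1 + (𝟙 (suc t <ᵇ k) + 𝟙 (0 <ᵇ t)))
      ≡⟨ regroup (𝟙 (t ≡ᵇ 0)) (𝟙 (suc t ≡ᵇ k)) (𝟙 (suc t <ᵇ k)) (𝟙 (0 <ᵇ t)) ⟩
    (𝟙 (t ≡ᵇ 0) + 𝟙 (0 <ᵇ t)) + (𝟙 (suc t ≡ᵇ k) + 𝟙 (suc t <ᵇ k))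
      ≡⟨ cong₂ _+_ (zero-or-positive t) (equal-or-less (toℕ<n i)) ⟩
    2 ∎
    where
    open ≡-Reasoning
    t = toℕ i
    regroup : ∀ x y z w → x * 1 + (y * 1 + (z + w)) ≡ (x + w) + (y + z)
    regroup = solve-∀

  Π-pathJoin : ∀ f → Πf f (G₁P[ k ]G₂ G₁ G₂ u v)
                   ≡ f (suc (deg G₁ u)) * f (suc (deg G₂ v)) * sharedFactor f k G₁ G₂ u v
  Π-pathJoin f = begin
    Πf f (G₁P[ k ]G₂ G₁ G₂ u v)
      ≡⟨ Π-blocks f ⟩
    ∏ (λ a → f (blockDegree A (inj₁ a)))
      * (∏ (λ b → f (blockDegree A (inj₂ (inj₁ b)))) * ∏ (λ i → f (blockDegree A (inj₂ (inj₂ i)))))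
      ≡⟨ cong₂ _*_ (trans (∏-cong (cong f ∘ deg-G₁)) (∏-bump f (deg G₁) u 1))
                   (cong₂ _*_ (trans (∏-cong (cong f ∘ deg-G₂)) (∏-bump f (deg G₂) v 1))
                              (trans (∏-cong (cong f ∘ deg-path)) (∏-const k (f 2)))) ⟩
    (f (suc (deg G₁ u)) * R₁) * ((f (suc (deg G₂ v)) * R₂) * f 2 ^ k)
      ≡⟨ regroup (f (suc (deg G₁ u))) (f (suc (deg G₂ v))) R₁ R₂ (f 2 ^ k) ⟩
    f (suc (deg G₁ u)) * f (suc (deg G₂ v)) * sharedFactor f k G₁ G₂ u v ∎
    where
    open ≡-Reasoning
    R₁ = ∏ (λ j → f (deg G₁ (punchIn u j)))
    R₂ = ∏ (λ j → f (deg G₂ (punchIn v j)))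
    regroup : ∀ x y R₁ R₂ p → (x * R₁) * ((y * R₂) * p) ≡ x * y * (R₁ * (R₂ * p))
    regroup = solve-∀

module IdentifyDegrees {n₁ n₂ : ℕ} (k : ℕ) (G₁ : Graph (suc n₁)) (G₂ : Graph (suc n₂))
                       (u : Fin (suc n₁)) (v : Fin (suc n₂)) where
  open Identify {k = k} G₁ G₂ u v using (A; dec)

  dec≗split₃ : ∀ x → dec x ≡ split₃ (suc n₁) n₂ (suc k) x
  dec≗split₃ x with splitAt (suc n₁) x
  ... | inj₁ _ = refl
  ... | inj₂ _ = refl

  open Blocks (G₁G₂P[ k ] G₁ G₂ u v) A (λ x y → cong₂ A (dec≗split₃ x) (dec≗split₃ y)) using (Π-blocks)

  deg-G₁ : ∀ a → blockDegree A (inj₁ a) ≡ 𝟙 (a =F u) * suc (deg G₂ v) + deg G₁ a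
  deg-G₁ a = begin
    blockDegree A (inj₁ a)
      ≡⟨ cong₂ _+_ (sym (deg-∑ G₁ a)) (cong₂ _+_ via-v via-path) ⟩
    deg G₁ a + (𝟙 c * deg G₂ v + 𝟙 c * 1)
      ≡⟨ regroup (deg G₁ a) (𝟙 c) (deg G₂ v) ⟩
    𝟙 c * suc (deg G₂ v) + deg G₁ a ∎
    where
    open ≡-Reasoning
    c = a =F u
    v-neighbours : deg G₂ v ≡ ∑ (λ b → 𝟙 (adj G₂ v (punchIn v b)))
    v-neighbours = trans (deg-remove G₂ v v)
                         (cong (λ z → 𝟙 z + ∑ (λ b → 𝟙 (adj G₂ v (punchIn v b)))) (adj-irr G₂ v))
    via-v : ∑ (λ b → 𝟙 (c ∧ adj G₂ v (punchIn v b))) ≡ 𝟙 c * deg G₂ v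
    via-v = trans (∑-guardˡ c (adj G₂ v ∘ punchIn v)) (cong (𝟙 c *_) (sym v-neighbours))
    via-path : ∑ (λ (i : Fin (suc k)) → 𝟙 (c ∧ (toℕ i ≡ᵇ 0))) ≡ 𝟙 c * 1
    via-path = trans (∑-guardˡ c (λ (i : Fin (suc k)) → toℕ i ≡ᵇ 0))
                     (cong (𝟙 c *_) (count-index (suc k) 0))
    regroup : ∀ d x e → d + (x * e + x * 1) ≡ x * suc e + d
    regroup = solve-∀

  -- The other vertices of G₂ keep their degree (an edge to v becomes one to w).
  deg-G₂ : ∀ b → blockDegree A (inj₂ (inj₁ b)) ≡ deg G₂ (punchIn v b)
  deg-G₂ b = begin
    blockDegree A (inj₂ (inj₁ b))
      ≡⟨ cong₂ _+_ (trans (∑-guardʳ e (_=F u)) (trans (cong (𝟙 e *_) (count-=F u)) (*-identityʳ (𝟙 e))))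
                   (trans (cong (R +_) (sum-replicate-zero (suc k))) (+-identityʳ R)) ⟩
    𝟙 e + R
      ≡⟨ cong (λ z → 𝟙 z + R) (adj-sym G₂ v x) ⟩
    𝟙 (adj G₂ x v) + R
      ≡⟨ sym (deg-remove G₂ x v) ⟩
    deg G₂ x ∎
    where
    open ≡-Reasoning
    x = punchIn v b
    e = adj G₂ v x
    R = ∑ (λ b′ → 𝟙 (adj G₂ x (punchIn v b′)))

  deg-path : ∀ i → blockDegree A (inj₂ (inj₂ i)) ≡ suc (𝟙 (toℕ i <ᵇ k))
  deg-path i = begin
    blockDegree A (inj₂ (inj₂ i))
      ≡⟨ cong₂ _+_ (trans (∑-guardʳ (t ≡ᵇ 0) (_=F u)) (cong (𝟙 (t ≡ᵇ 0) *_) (count-=F u)))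
                   (cong₂ _+_ (sum-replicate-zero n₂) (path-degree i)) ⟩
    𝟙 (t ≡ᵇ 0) * 1 + (𝟙 (t <ᵇ k) + 𝟙 (0 <ᵇ t))
      ≡⟨ regroup (𝟙 (t ≡ᵇ 0)) (𝟙 (t <ᵇ k)) (𝟙 (0 <ᵇ t)) ⟩
    (𝟙 (t ≡ᵇ 0) + 𝟙 (0 <ᵇ t)) + 𝟙 (t <ᵇ k)
      ≡⟨ cong (_+ 𝟙 (t <ᵇ k)) (zero-or-positive t) ⟩
    suc (𝟙 (t <ᵇ k)) ∎
    where
    open ≡-Reasoning
    t = toℕ i
    regroup : ∀ x y z → x * 1 + (y + z) ≡ (x + z) + y
    regroup = solve-∀

  Π-identify : ∀ f → Πf f (G₁G₂P[ k ] G₁ G₂ u v)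
                   ≡ f (suc (deg G₂ v + deg G₁ u)) * f 1 * sharedFactor f k G₁ G₂ u v
  Π-identify f = begin
    Πf f (G₁G₂P[ k ] G₁ G₂ u v)
      ≡⟨ Π-blocks f ⟩
    ∏ (λ a → f (blockDegree A (inj₁ a)))
      * (∏ (λ b → f (blockDegree A (inj₂ (inj₁ b)))) * ∏ (λ i → f (blockDegree A (inj₂ (inj₂ i)))))
      ≡⟨ cong₂ _*_ (trans (∏-cong (cong f ∘ deg-G₁)) (∏-bump f (deg G₁) u (suc (deg G₂ v))))
                   (cong₂ _*_ (∏-cong (cong f ∘ deg-G₂))
                              (trans (∏-cong (cong f ∘ deg-path)) (∏-pendent-path k f))) ⟩
    (f (suc (deg G₂ v + deg G₁ u)) * R₁) * (R₂ * (f 2 ^ k * f 1))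
      ≡⟨ regroup (f (suc (deg G₂ v + deg G₁ u))) (f 1) R₁ R₂ (f 2 ^ k) ⟩
    f (suc (deg G₂ v + deg G₁ u)) * f 1 * sharedFactor f k G₁ G₂ u v ∎
    where
    open ≡-Reasoning
    R₁ = ∏ (λ j → f (deg G₁ (punchIn u j)))
    R₂ = ∏ (λ j → f (deg G₂ (punchIn v j)))
    regroup : ∀ x y R₁ R₂ p → (x * R₁) * (R₂ * (p * y)) ≡ x * y * (R₁ * (R₂ * p))
    regroup = solve-∀

lemma2p4 : (n₁ n₂ k : ℕ) (G₁ : Graph n₁) (G₂ : Graph (suc n₂))
    → Connected G₁ → Connected G₂
    → (u : Fin n₁) (v : Fin (suc n₂))
    → (Pi1 (G₁P[ k ]G₂ G₁ G₂ u v) ≥ Pi1 (G₁G₂P[ k ] G₁ G₂ u v))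
      × (Pi2 (G₁P[ k ]G₂ G₁ G₂ u v) ≤ Pi2 (G₁G₂P[ k ] G₁ G₂ u v))
lemma2p4 zero n₂ k G₁ G₂ _ _ () v
lemma2p4 (suc n₁) n₂ k G₁ G₂ _ _ u v = Π₁-decreases , Π₂-increases
  where
  open ≤-Reasoning
  open PathJoinDegrees k G₁ G₂ u v using (Π-pathJoin)
  open IdentifyDegrees k G₁ G₂ u v using (Π-identify)
  a = deg G₁ u
  b = deg G₂ v
  P = G₁P[ k ]G₂ G₁ G₂ u v
  I = G₁G₂P[ k ] G₁ G₂ u v
  R : (ℕ → ℕ) → ℕ
  R f = sharedFactor f k G₁ G₂ u v

  Π₁-decreases : Pi1 I ≤ Pi1 P
  Π₁-decreases = begin
    Pi1 I                               ≡⟨ foldr-allFin _*_ 1 (λ x → deg I x ^ 2) ⟩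
    Πf (_^ 2) I                         ≡⟨ Π-identify (_^ 2) ⟩
    suc (b + a) ^ 2 * 1 ^ 2 * R (_^ 2)  ≤⟨ *-monoˡ-≤ _ (Π₁-local a b) ⟩
    suc a ^ 2 * suc b ^ 2 * R (_^ 2)    ≡⟨ Π-pathJoin (_^ 2) ⟨
    Πf (_^ 2) P                         ≡⟨ foldr-allFin _*_ 1 (λ x → deg P x ^ 2) ⟨
    Pi1 P                               ∎

  Π₂-increases : Pi2 P ≤ Pi2 I
  Π₂-increases = begin
    Pi2 P                                                ≡⟨ foldr-allFin _*_ 1 (λ x → deg P x ^ deg P x) ⟩
    Πf (λ d → d ^ d) P                                   ≡⟨ Π-pathJoin (λ d → d ^ d) ⟩
    suc a ^ suc a * suc b ^ suc b * R (λ d → d ^ d)      ≤⟨ *-monoˡ-≤ _ (Π₂-local a b) ⟩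
    suc (b + a) ^ suc (b + a) * 1 ^ 1 * R (λ d → d ^ d)  ≡⟨ Π-identify (λ d → d ^ d) ⟨
    Πf (λ d → d ^ d) I                                   ≡⟨ foldr-allFin _*_ 1 (λ x → deg I x ^ deg I x) ⟨
    Pi2 I                                                ∎
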